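{- Let $\mathfrak{M}$ be a listable $\mathscr{L}$-structure and let $\rho,\gamma$ be listable presentations of $\mathfrak{M}$. Consider: (i) $\rho$ and $\gamma$ are equivalent; (ii) the class of $\rho$-listable sets equals the class of $\gamma$-listable sets; (iii) the class of $\rho$-listable sets is contained in the class of $\gamma$-listable sets. Then (i) implies (ii) and (ii) implies (iii). Furthermore, if $E_\rho=\{(m,n)\in\mathbb{N}^2:\rho(m)=\rho(n)\}$ is decidable, then (i), (ii), (iii) are equivalent.
   Context: All languages contain $=$, interpreted as equality. Listable means recursively enumerable. For $\rho:\mathbb{N}\to M$ and $S\subseteq M^r$, $\rho^*(S)$ is the preimage of $S$ under the coordinatewise map $\mathbb{N}^r\to M^r$. A listable presentation of $\mathfrak{M}$ (domain $M$) is a surjection $\rho:\mathbb{N}\to M$ with $\rho^*(s^{\mathfrak{M}})$ listable for every symbol $s\in\mathscr{L}$ (function symbols via graphs). $X\subseteq M^r$ is $\rho$-listable if $\rho^*(X)$ is listable. $\rho$ and $\gamma$ are equivalent if $\gamma=\rho\circ\phi$ for some total recursive $\phi:\mathbb{N}\to\mathbb{N}$. -}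

module Defs where

open import Data.Nat using (ℕ; zero; suc; _<_)
open import Data.Fin using (Fin)
open import Data.Vec using (Vec; []; _∷_; lookup; map; init; last)
open import Data.Product using (Σ; ∃; _×_; _,_)
open import Data.Sum using (_⊎_)
open import Relation.Nullary using (¬_)
open import Relation.Binary.PropositionalEquality using (_≡_)
open import Function.Bundles using (_⇔_)

data Code : ℕ → Set where
  cz   : ∀ {k} → Code k
  succ : Code 1
  proj : ∀ {k} → Fin k → Code k
  comp : ∀ {k m} → Code m → Vec (Code k) m → Code k
  prec : ∀ {k} → Code k → Code (suc (suc k)) → Code (suc k)
  mu   : ∀ {k} → Code (suc k) → Code k

mutual
  data Eval : ∀ {k} → Code k → Vec ℕ k → ℕ → Set where
    ev-cz   : ∀ {k} {xs : Vec ℕ k} → Eval cz xs 0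
    ev-succ : ∀ {x} → Eval succ (x ∷ []) (suc x)
    ev-proj : ∀ {k} {i : Fin k} {xs} → Eval (proj i) xs (lookup xs i)
    ev-comp : ∀ {k m} {f : Code m} {gs : Vec (Code k) m} {xs ys z} →
              EvalAll gs xs ys → Eval f ys z → Eval (comp f gs) xs z
    ev-prec0 : ∀ {k} {f : Code k} {g} {xs z} →
               Eval f xs z → Eval (prec f g) (0 ∷ xs) z
    ev-precS : ∀ {k} {f : Code k} {g} {n xs y z} →
               Eval (prec f g) (n ∷ xs) y → Eval g (n ∷ y ∷ xs) z →
               Eval (prec f g) (suc n ∷ xs) z
    ev-mu   : ∀ {k} {f : Code (suc k)} {xs n} →
              Eval f (n ∷ xs) 0 →
              (∀ i → i < n → Σ ℕ λ v → Eval f (i ∷ xs) (suc v)) →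
              Eval (mu f) xs n

  data EvalAll : ∀ {k m} → Vec (Code k) m → Vec ℕ k → Vec ℕ m → Set where
    []  : ∀ {k} {xs : Vec ℕ k} → EvalAll [] xs []
    _∷_ : ∀ {k m} {g : Code k} {gs : Vec (Code k) m} {xs y ys} →
          Eval g xs y → EvalAll gs xs ys → EvalAll (g ∷ gs) xs (y ∷ ys)

Listable : ∀ {r} → (Vec ℕ r → Set) → Set
Listable {r} S = Σ (Code r) λ e → ∀ xs → S xs ⇔ (Σ ℕ λ y → Eval e xs y)

DecidableSet : ∀ {r} → (Vec ℕ r → Set) → Set
DecidableSet {r} S = Σ (Code r) λ e →
  ∀ xs → (S xs × Eval e xs 0) ⊎ (¬ S xs × Eval e xs 1)

TotalRecursive : (ℕ → ℕ) → Set
TotalRecursive φ = Σ (Code 1) λ e → ∀ n → Eval e (n ∷ []) (φ n)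

-- Languages and structures (equality is always in the language and is
-- interpreted as true equality; function symbols are handled via graphs).

record Language : Set₁ where
  field
    RelSym   : Set
    relArity : RelSym → ℕ
    FunSym   : Set
    funArity : FunSym → ℕ   -- constants are function symbols of arity 0

record Structure (L : Language) : Set₁ where
  open Language L
  field
    Carrier : Set
    rel     : (R : RelSym) → Vec Carrier (relArity R) → Set
    fun     : (F : FunSym) → Vec Carrier (funArity F) → Carrier

Graph : ∀ {M : Set} {n} → (Vec M n → M) → Vec M (suc n) → Set
Graph f v = f (init v) ≡ last v

pullback : ∀ {M : Set} {r} → (ℕ → M) → (Vec M r → Set) → Vec ℕ r → Set
pullback ρ S xs = S (map ρ xs)

EqRel : ∀ {M : Set} → Vec M 2 → Set
EqRel (x ∷ y ∷ []) = x ≡ y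

Surjective : ∀ {M : Set} → (ℕ → M) → Set
Surjective {M} ρ = ∀ (x : M) → Σ ℕ λ n → ρ n ≡ x

record ListablePresentation {L : Language} (𝔐 : Structure L)
       (ρ : ℕ → Structure.Carrier 𝔐) : Set where
  open Language L
  open Structure 𝔐
  field
    surjective : Surjective ρ
    eqListable  : Listable (pullback ρ EqRel)
    relListable : ∀ (R : RelSym) → Listable (pullback ρ (rel R))
    funListable : ∀ (F : FunSym) → Listable (pullback ρ (Graph (fun F)))

ListableStructure : ∀ {L : Language} → Structure L → Set
ListableStructure 𝔐 = Σ (ℕ → Structure.Carrier 𝔐) λ ρ → ListablePresentation 𝔐 ρ

ρListable : ∀ {M : Set} {r} → (ℕ → M) → (Vec M r → Set) → Set
ρListable ρ X = Listable (pullback ρ X)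

EquivalentPres : ∀ {M : Set} → (ℕ → M) → (ℕ → M) → Set
EquivalentPres ρ γ = Σ (ℕ → ℕ) λ φ → TotalRecursive φ × (∀ n → γ n ≡ ρ (φ n))

ClassIncluded : ∀ {M : Set} → (ℕ → M) → (ℕ → M) → Set₁
ClassIncluded {M} ρ γ = ∀ (r : ℕ) (X : Vec M r → Set) → ρListable ρ X → ρListable γ X

ClassEqual : ∀ {M : Set} → (ℕ → M) → (ℕ → M) → Set₁
ClassEqual ρ γ = ClassIncluded ρ γ × ClassIncluded γ ρ

Eq-of : ∀ {M : Set} → (ℕ → M) → Vec ℕ 2 → Set
Eq-of ρ (m ∷ n ∷ []) = ρ m ≡ ρ n

-- Index translations carry listability: if a total recursive c turns ρ-indices
-- into γ-indices of the same elements, composing a γ-listing code with c gives a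
-- ρ-listing code. An equivalence γ = ρ ∘ φ is such a translation from γ to ρ, and
-- one from ρ to γ is found by searching the listable relation γ j = ρ x.
--
-- For the converse, decidability of E_ρ makes the least index of each element
-- computable, so the canonical indices can be enumerated in increasing order,
-- k ↦ enum k. The successor relation of this enumeration, read on elements, is
-- ρ-listable, hence γ-listable by (iii); following it from a γ-index of ρ 0
-- produces a γ-index of each ρ (enum k). Hence ρ m = γ n is listable, and a
-- search through it is the required total recursive φ.
--
-- Searching a listable relation needs dovetailing, done here with an evaluator of
-- codes whose μ-searches are cut off by a clock.

module Submission where

open import Defs
open import Data.Nat using (ℕ; zero; suc; _<_; _≤_; _+_; _∸_; z≤n; s≤s; pred; _⊔_; _≟_; _≤?_)
open import Data.Nat.Properties
open import Data.Fin using (Fin; _↑ʳ_) renaming (zero to fzero; suc to fsuc)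
open import Data.Vec using (Vec; []; _∷_; lookup; map; tabulate; _++_; allFin)
open import Data.Vec.Properties using (lookup-++ʳ; tabulate∘lookup; tabulate-cong; map-lookup-allFin)
open import Data.Product using (Σ; _×_; _,_; proj₁; proj₂)
open import Data.Sum using (_⊎_; inj₁; inj₂)
open import Data.Empty using (⊥-elim)
open import Relation.Nullary using (¬_; yes; no)
open import Function.Bundles using (_⇔_; mk⇔; Equivalence)
open import Function.Construct.Composition using (_⇔-∘_)
open import Relation.Binary.PropositionalEquality
open import Relation.Binary.Definitions using (tri<; tri≈; tri>)

mutual
  Eval-deterministic : ∀ {k} {e : Code k} {xs y z} → Eval e xs y → Eval e xs z → y ≡ z
  Eval-deterministic ev-cz ev-cz = refl
  Eval-deterministic ev-succ ev-succ = refl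
  Eval-deterministic ev-proj ev-proj = refl
  Eval-deterministic (ev-comp as d) (ev-comp bs d′) with EvalAll-deterministic as bs
  ... | refl = Eval-deterministic d d′
  Eval-deterministic (ev-prec0 d) (ev-prec0 d′) = Eval-deterministic d d′
  Eval-deterministic (ev-precS r d) (ev-precS r′ d′) with Eval-deterministic r r′
  ... | refl = Eval-deterministic d d′
  Eval-deterministic (ev-mu {n = n} d below) (ev-mu {n = n′} d′ below′) with <-cmp n n′
  ... | tri< n<n′ _ _ = ⊥-elim (0≢1+n (Eval-deterministic d (proj₂ (below′ n n<n′))))
  ... | tri≈ _ n≡n′ _ = n≡n′
  ... | tri> _ _ n′<n = ⊥-elim (0≢1+n (Eval-deterministic d′ (proj₂ (below n′ n′<n))))

  EvalAll-deterministic : ∀ {k m} {gs : Vec (Code k) m} {xs ys zs} →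
                          EvalAll gs xs ys → EvalAll gs xs zs → ys ≡ zs
  EvalAll-deterministic [] [] = refl
  EvalAll-deterministic (d ∷ ds) (d′ ∷ ds′) =
    cong₂ _∷_ (Eval-deterministic d d′) (EvalAll-deterministic ds ds′)

Computable : ∀ k → (Vec ℕ k → ℕ) → Set
Computable k f = Σ (Code k) λ c → ∀ xs → Eval c xs (f xs)

Computable₁ : (ℕ → ℕ) → Set
Computable₁ f = Computable 1 λ { (x ∷ []) → f x }

Computable₂ : (ℕ → ℕ → ℕ) → Set
Computable₂ f = Computable 2 λ { (x ∷ y ∷ []) → f x y }

Computable-cong : ∀ {k f g} → (∀ xs → f xs ≡ g xs) → Computable k f → Computable k g
Computable-cong f≗g (c , ev) = c , λ xs → subst (Eval c xs) (f≗g xs) (ev xs)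

zero-computable : ∀ {k} → Computable k (λ _ → 0)
zero-computable = cz , λ _ → ev-cz

suc-computable : Computable₁ suc
suc-computable = succ , λ { (x ∷ []) → ev-succ }

lookup-computable : ∀ {k} (i : Fin k) → Computable k (λ xs → lookup xs i)
lookup-computable i = proj i , λ _ → ev-proj

data Term (k : ℕ) : Set where
  var : Fin k → Term k
  app : ∀ {m} {f : Vec ℕ m → ℕ} → Computable m f → Vec (Term k) m → Term k

mutual
  ⟦_⟧ : ∀ {k} → Term k → Vec ℕ k → ℕ
  ⟦ var i ⟧ xs = lookup xs i
  ⟦ app {f = f} _ ts ⟧ xs = f (⟦ ts ⟧* xs)

  ⟦_⟧* : ∀ {k m} → Vec (Term k) m → Vec ℕ k → Vec ℕ m
  ⟦ [] ⟧* xs = []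
  ⟦ t ∷ ts ⟧* xs = ⟦ t ⟧ xs ∷ ⟦ ts ⟧* xs

mutual
  compile : ∀ {k} → Term k → Code k
  compile (var i) = proj i
  compile (app c ts) = comp (proj₁ c) (compile* ts)

  compile* : ∀ {k m} → Vec (Term k) m → Vec (Code k) m
  compile* [] = []
  compile* (t ∷ ts) = compile t ∷ compile* ts

mutual
  compile-correct : ∀ {k} (t : Term k) xs → Eval (compile t) xs (⟦ t ⟧ xs)
  compile-correct (var i) xs = ev-proj
  compile-correct (app c ts) xs = ev-comp (compile*-correct ts xs) (proj₂ c _)

  compile*-correct : ∀ {k m} (ts : Vec (Term k) m) xs → EvalAll (compile* ts) xs (⟦ ts ⟧* xs)
  compile*-correct [] xs = []
  compile*-correct (t ∷ ts) xs = compile-correct t xs ∷ compile*-correct ts xs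

computable-term : ∀ {k f} (t : Term k) → (∀ xs → ⟦ t ⟧ xs ≡ f xs) → Computable k f
computable-term t ⟦t⟧≗f = Computable-cong ⟦t⟧≗f (compile t , compile-correct t)

app₁ : ∀ {k} {f : ℕ → ℕ} → Computable₁ f → Term k → Term k
app₁ c t = app c (t ∷ [])

app₂ : ∀ {k} {f : ℕ → ℕ → ℕ} → Computable₂ f → Term k → Term k → Term k
app₂ c t u = app c (t ∷ u ∷ [])

const-computable : ∀ {k} n → Computable k (λ _ → n)
const-computable zero = zero-computable
const-computable (suc n) = computable-term (app₁ suc-computable (app (const-computable n) [])) λ _ → refl

⟦tabulate⟧ : ∀ {k m} (f : Fin m → Term k) xs → ⟦ tabulate f ⟧* xs ≡ tabulate (λ i → ⟦ f i ⟧ xs)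
⟦tabulate⟧ {m = zero} f xs = refl
⟦tabulate⟧ {m = suc m} f xs = cong (⟦ f fzero ⟧ xs ∷_) (⟦tabulate⟧ (λ i → f (fsuc i)) xs)

varsAfter : ∀ j {k} → Vec (Term (j + k)) k
varsAfter j = tabulate (λ i → var (j ↑ʳ i))

⟦varsAfter⟧ : ∀ j {k} (ys : Vec ℕ j) (xs : Vec ℕ k) → ⟦ varsAfter j ⟧* (ys ++ xs) ≡ xs
⟦varsAfter⟧ j ys xs = begin
  ⟦ varsAfter j ⟧* (ys ++ xs)                 ≡⟨ ⟦tabulate⟧ _ (ys ++ xs) ⟩
  tabulate (λ i → lookup (ys ++ xs) (j ↑ʳ i)) ≡⟨ tabulate-cong (lookup-++ʳ ys xs) ⟩
  tabulate (lookup xs)                        ≡⟨ tabulate∘lookup xs ⟩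
  xs                                          ∎
  where open ≡-Reasoning

identityCodes : ∀ k → Vec (Code k) k
identityCodes k = compile* (varsAfter 0)

identityCodes-eval : ∀ {k} (xs : Vec ℕ k) → EvalAll (identityCodes k) xs xs
identityCodes-eval xs = subst (EvalAll _ xs) (⟦varsAfter⟧ 0 [] xs) (compile*-correct (varsAfter 0) xs)

primRec : ∀ {k} → (Vec ℕ k → ℕ) → (Vec ℕ (suc (suc k)) → ℕ) → Vec ℕ (suc k) → ℕ
primRec f g (zero ∷ xs) = f xs
primRec f g (suc n ∷ xs) = g (n ∷ primRec f g (n ∷ xs) ∷ xs)

primRec-computable : ∀ {k f g} → Computable k f → Computable (suc (suc k)) g →
                     Computable (suc k) (primRec f g)
primRec-computable {f = f} {g} (cf , evf) (cg , evg) = prec cf cg , ev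
  where
  ev : ∀ xs → Eval (prec cf cg) xs (primRec f g xs)
  ev (zero ∷ xs) = ev-prec0 (evf xs)
  ev (suc n ∷ xs) = ev-precS (ev (n ∷ xs)) (evg _)

caseℕ : ∀ {k} → (Vec ℕ k → ℕ) → (Vec ℕ (suc k) → ℕ) → Vec ℕ (suc k) → ℕ
caseℕ f g (zero ∷ xs) = f xs
caseℕ f g (suc n ∷ xs) = g (n ∷ xs)

caseℕ-computable : ∀ {k f g} → Computable k f → Computable (suc k) g →
                   Computable (suc k) (caseℕ f g)
caseℕ-computable {k} {f} {g} cf cg =
  Computable-cong agree (primRec-computable cf (computable-term g′ λ _ → refl))
  where
  g′ : Term (suc (suc k))
  g′ = app cg (var fzero ∷ varsAfter 2)
  agree : ∀ xs → primRec f ⟦ g′ ⟧ xs ≡ caseℕ f g xs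
  agree (zero ∷ xs) = refl
  agree (suc n ∷ xs) =
    cong (λ ys → g (n ∷ ys)) (⟦varsAfter⟧ 2 (n ∷ primRec f ⟦ g′ ⟧ (n ∷ xs) ∷ []) xs)

ifPos : ℕ → ℕ → ℕ
ifPos zero b = 0
ifPos (suc _) b = b

isZero : ℕ → ℕ
isZero zero = 1
isZero (suc _) = 0

_orElse_ : ℕ → ℕ → ℕ
zero orElse a = a
suc r orElse a = suc r

pred-computable : Computable₁ pred
pred-computable = Computable-cong (λ { (zero ∷ []) → refl ; (suc n ∷ []) → refl })
  (caseℕ-computable (const-computable 0) (lookup-computable fzero))

isZero-computable : Computable₁ isZero
isZero-computable = Computable-cong (λ { (zero ∷ []) → refl ; (suc n ∷ []) → refl })
  (caseℕ-computable (const-computable 1) (const-computable 0))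

ifPos-computable : Computable₂ ifPos
ifPos-computable = Computable-cong (λ { (zero ∷ b ∷ []) → refl ; (suc a ∷ b ∷ []) → refl })
  (caseℕ-computable (const-computable 0) (lookup-computable (fsuc fzero)))

orElse-computable : Computable₂ _orElse_
orElse-computable = Computable-cong (λ { (zero ∷ a ∷ []) → refl ; (suc r ∷ a ∷ []) → refl })
  (caseℕ-computable (lookup-computable fzero) (computable-term (app₁ suc-computable (var fzero)) λ _ → refl))

∸-computable : Computable₂ _∸_
∸-computable = computable-term (app subtract (var (fsuc fzero) ∷ var fzero ∷ [])) λ { (a ∷ b ∷ []) → agree b a }
  where
  flipped∸ : Vec ℕ 2 → ℕ
  flipped∸ = primRec (λ xs → lookup xs fzero) (λ xs → pred (lookup xs (fsuc fzero)))
  subtract : Computable 2 flipped∸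
  subtract = primRec-computable (lookup-computable fzero)
    (computable-term (app₁ pred-computable (var (fsuc fzero))) λ _ → refl)
  agree : ∀ b a → flipped∸ (b ∷ a ∷ []) ≡ a ∸ b
  agree zero a = refl
  agree (suc b) a = trans (cong pred (agree b a)) (pred[m∸n]≡m∸[1+n] a b)

allPositive : ∀ {m} → Vec ℕ m → ℕ
allPositive [] = 1
allPositive (v ∷ vs) = ifPos v (allPositive vs)

allPositive-computable : ∀ m → Computable m allPositive
allPositive-computable zero = Computable-cong (λ { [] → refl }) (const-computable 1)
allPositive-computable (suc m) =
  computable-term (app₂ ifPos-computable (var fzero) (app (allPositive-computable m) (varsAfter 1)))
    λ { (v ∷ vs) → cong (λ ws → ifPos v (allPositive ws)) (⟦varsAfter⟧ 1 (v ∷ []) vs) }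

⟦map-app₁⟧ : ∀ {k m} {f : ℕ → ℕ} (c : Computable₁ f) (ts : Vec (Term k) m) xs →
             ⟦ map (app₁ c) ts ⟧* xs ≡ map f (⟦ ts ⟧* xs)
⟦map-app₁⟧ c [] xs = refl
⟦map-app₁⟧ c (t ∷ ts) xs = cong (_ ∷_) (⟦map-app₁⟧ c ts xs)

-- Clocked evaluation

searchStep : ℕ → ℕ → ℕ
searchStep zero c = 1
searchStep (suc zero) c = suc (suc c)
searchStep (suc (suc _)) c = 0

searchStep-computable : Computable₂ searchStep
searchStep-computable = Computable-cong
  (λ { (zero ∷ c ∷ []) → refl ; (suc zero ∷ c ∷ []) → refl ; (suc (suc v) ∷ c ∷ []) → refl })
  (caseℕ-computable (const-computable 1)
    (caseℕ-computable (computable-term (app₁ suc-computable (app₁ suc-computable (var fzero))) λ _ → refl)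
                      (const-computable 0)))

-- clocked e t xs runs e on xs with every μ-search cut off at t: it is 0 when no
-- output is found, and suc y when the output y is found.
mutual
  clocked : ∀ {k} → Code k → ℕ → Vec ℕ k → ℕ
  clocked cz t xs = 1
  clocked succ t (x ∷ []) = suc (suc x)
  clocked (proj i) t xs = suc (lookup xs i)
  clocked (comp f gs) t xs =
    ifPos (allPositive (clocked* gs t xs)) (clocked f t (map pred (clocked* gs t xs)))
  clocked (prec f g) t (n ∷ xs) = clockedRec f g t n xs
  clocked (mu f) t xs = pred (clockedSearch f t xs t)

  clocked* : ∀ {k m} → Vec (Code k) m → ℕ → Vec ℕ k → Vec ℕ m
  clocked* [] t xs = []
  clocked* (g ∷ gs) t xs = clocked g t xs ∷ clocked* gs t xs

  clockedRec : ∀ {k} → Code k → Code (suc (suc k)) → ℕ → ℕ → Vec ℕ k → ℕ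
  clockedRec f g t zero xs = clocked f t xs
  clockedRec f g t (suc n) xs =
    ifPos (clockedRec f g t n xs) (clocked g t (n ∷ pred (clockedRec f g t n xs) ∷ xs))

  -- Scans i < c: 0 if all of them give a positive value, 1 if one gives no value
  -- before a zero is met, and 2 + i if i is the first zero.
  clockedSearch : ∀ {k} → Code (suc k) → ℕ → Vec ℕ k → ℕ → ℕ
  clockedSearch f t xs zero = 0
  clockedSearch f t xs (suc c) = clockedSearch f t xs c orElse searchStep (clocked f t (c ∷ xs)) c

clockedᵛ : ∀ {k} → Code k → Vec ℕ (suc k) → ℕ
clockedᵛ e (t ∷ xs) = clocked e t xs

clockedRecᵛ : ∀ {k} → Code k → Code (suc (suc k)) → Vec ℕ (suc (suc k)) → ℕ
clockedRecᵛ f g (n ∷ t ∷ xs) = clockedRec f g t n xs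

clockedSearchᵛ : ∀ {k} → Code (suc k) → Vec ℕ (suc (suc k)) → ℕ
clockedSearchᵛ f (c ∷ t ∷ xs) = clockedSearch f t xs c

recStep : ∀ {k} → Code (suc (suc k)) → Vec ℕ (suc (suc (suc k))) → ℕ
recStep g (n ∷ r ∷ t ∷ xs) = ifPos r (clocked g t (n ∷ pred r ∷ xs))

searchStepᵛ : ∀ {k} → Code (suc k) → Vec ℕ (suc (suc (suc k))) → ℕ
searchStepᵛ f (c ∷ r ∷ t ∷ xs) = r orElse searchStep (clocked f t (c ∷ xs)) c

clockedRec-primRec : ∀ {k} (f : Code k) g n t xs →
                     primRec (clockedᵛ f) (recStep g) (n ∷ t ∷ xs) ≡ clockedRec f g t n xs
clockedRec-primRec f g zero t xs = refl
clockedRec-primRec f g (suc n) t xs =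
  cong (λ r → ifPos r (clocked g t (n ∷ pred r ∷ xs))) (clockedRec-primRec f g n t xs)

clockedSearch-primRec : ∀ {k} (f : Code (suc k)) c t xs →
                        primRec (λ _ → 0) (searchStepᵛ f) (c ∷ t ∷ xs) ≡ clockedSearch f t xs c
clockedSearch-primRec f zero t xs = refl
clockedSearch-primRec f (suc c) t xs =
  cong (_orElse searchStep (clocked f t (c ∷ xs)) c) (clockedSearch-primRec f c t xs)

mutual
  clocked-computable : ∀ {k} (e : Code k) → Computable (suc k) (clockedᵛ e)
  clocked-computable cz = Computable-cong (λ { (t ∷ xs) → refl }) (const-computable 1)
  clocked-computable succ =
    computable-term (app₁ suc-computable (app₁ suc-computable (var (fsuc fzero)))) λ { (t ∷ x ∷ []) → refl }
  clocked-computable (proj i) = computable-term (app₁ suc-computable (var (fsuc i))) λ { (t ∷ xs) → refl }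
  clocked-computable (comp f gs) = computable-term
    (app₂ ifPos-computable (app (allPositive-computable _) (clocked*-terms gs))
                           (app (clocked-computable f) (var fzero ∷ map (app₁ pred-computable) (clocked*-terms gs))))
    λ { (t ∷ xs) → cong₂ (λ as bs → ifPos (allPositive as) (clocked f t bs))
                     (⟦clocked*-terms⟧ gs t xs)
                     (trans (⟦map-app₁⟧ pred-computable (clocked*-terms gs) (t ∷ xs))
                            (cong (map pred) (⟦clocked*-terms⟧ gs t xs))) }
  clocked-computable (prec f g) = computable-term
    (app (clockedRec-computable f g) (var (fsuc fzero) ∷ var fzero ∷ varsAfter 2))
    λ { (t ∷ n ∷ xs) → cong (λ ys → clockedRecᵛ f g (n ∷ t ∷ ys)) (⟦varsAfter⟧ 2 (t ∷ n ∷ []) xs) }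
  clocked-computable (mu f) = computable-term
    (app₁ pred-computable (app (clockedSearch-computable f) (var fzero ∷ var fzero ∷ varsAfter 1)))
    λ { (t ∷ xs) → cong (λ ys → pred (clockedSearch f t ys t)) (⟦varsAfter⟧ 1 (t ∷ []) xs) }

  clocked*-terms : ∀ {k m} → Vec (Code k) m → Vec (Term (suc k)) m
  clocked*-terms [] = []
  clocked*-terms (g ∷ gs) = app (clocked-computable g) (var fzero ∷ varsAfter 1) ∷ clocked*-terms gs

  ⟦clocked*-terms⟧ : ∀ {k m} (gs : Vec (Code k) m) t xs → ⟦ clocked*-terms gs ⟧* (t ∷ xs) ≡ clocked* gs t xs
  ⟦clocked*-terms⟧ [] t xs = refl
  ⟦clocked*-terms⟧ (g ∷ gs) t xs =
    cong₂ _∷_ (cong (clocked g t) (⟦varsAfter⟧ 1 (t ∷ []) xs)) (⟦clocked*-terms⟧ gs t xs)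

  clockedRec-computable : ∀ {k} (f : Code k) g → Computable (suc (suc k)) (clockedRecᵛ f g)
  clockedRec-computable f g =
    Computable-cong (λ { (n ∷ t ∷ xs) → clockedRec-primRec f g n t xs })
      (primRec-computable (clocked-computable f) (recStep-computable g))

  recStep-computable : ∀ {k} (g : Code (suc (suc k))) → Computable (suc (suc (suc k))) (recStep g)
  recStep-computable g = computable-term
    (app₂ ifPos-computable (var (fsuc fzero))
      (app (clocked-computable g)
        (var (fsuc (fsuc fzero)) ∷ var fzero ∷ app₁ pred-computable (var (fsuc fzero)) ∷ varsAfter 3)))
    λ { (n ∷ r ∷ t ∷ xs) → cong (λ ys → ifPos r (clocked g t (n ∷ pred r ∷ ys)))
                                (⟦varsAfter⟧ 3 (n ∷ r ∷ t ∷ []) xs) }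

  clockedSearch-computable : ∀ {k} (f : Code (suc k)) → Computable (suc (suc k)) (clockedSearchᵛ f)
  clockedSearch-computable f =
    Computable-cong (λ { (c ∷ t ∷ xs) → clockedSearch-primRec f c t xs })
      (primRec-computable (const-computable 0) (searchStepᵛ-computable f))

  searchStepᵛ-computable : ∀ {k} (f : Code (suc k)) → Computable (suc (suc (suc k))) (searchStepᵛ f)
  searchStepᵛ-computable f = computable-term
    (app₂ orElse-computable (var (fsuc fzero))
      (app₂ searchStep-computable
        (app (clocked-computable f) (var (fsuc (fsuc fzero)) ∷ var fzero ∷ varsAfter 3)) (var fzero)))
    λ { (c ∷ r ∷ t ∷ xs) → cong (λ ys → r orElse searchStep (clocked f t (c ∷ ys)) c)
                                (⟦varsAfter⟧ 3 (c ∷ r ∷ t ∷ []) xs) }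

ifPos-positive : ∀ a b {y} → ifPos a b ≡ suc y → Σ ℕ (λ a′ → a ≡ suc a′) × b ≡ suc y
ifPos-positive (suc a) b b≡1+y = (a , refl) , b≡1+y

pred≡suc : ∀ {a y} → pred a ≡ suc y → a ≡ suc (suc y)
pred≡suc {suc a} refl = refl

allPositive-map-suc : ∀ {m} (ys : Vec ℕ m) → allPositive (map suc ys) ≡ 1
allPositive-map-suc [] = refl
allPositive-map-suc (y ∷ ys) = allPositive-map-suc ys

map-pred-suc : ∀ {m} (ys : Vec ℕ m) → map pred (map suc ys) ≡ ys
map-pred-suc [] = refl
map-pred-suc (y ∷ ys) = cong (y ∷_) (map-pred-suc ys)

module _ {k} (f : Code (suc k)) (t : ℕ) (xs : Vec ℕ k) where

  ClockedPositive : ℕ → Set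
  ClockedPositive i = Σ ℕ λ v → clocked f t (i ∷ xs) ≡ suc (suc v)

  clockedSearch≡0 : ∀ c → clockedSearch f t xs c ≡ 0 → ∀ i → i < c → ClockedPositive i
  clockedSearch≡0 (suc c) eq i i<1+c with clockedSearch f t xs c in eq₁ | clocked f t (c ∷ xs) in eq₂
  clockedSearch≡0 (suc c) eq i i<1+c | zero | suc (suc v) with m<1+n⇒m<n∨m≡n i<1+c
  ... | inj₁ i<c = clockedSearch≡0 c eq₁ i i<c
  ... | inj₂ refl = v , eq₂
  clockedSearch≡0 (suc c) () i i<1+c | zero | zero
  clockedSearch≡0 (suc c) () i i<1+c | zero | suc zero
  clockedSearch≡0 (suc c) () i i<1+c | suc r | _

  clockedSearch≡2+ : ∀ c n → clockedSearch f t xs c ≡ suc (suc n) →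
                     clocked f t (n ∷ xs) ≡ 1 × (∀ i → i < n → ClockedPositive i)
  clockedSearch≡2+ (suc c) n eq with clockedSearch f t xs c in eq₁ | clocked f t (c ∷ xs) in eq₂
  clockedSearch≡2+ (suc c) .c refl | zero | suc zero = eq₂ , clockedSearch≡0 c eq₁
  clockedSearch≡2+ (suc c) n () | zero | zero
  clockedSearch≡2+ (suc c) n () | zero | suc (suc _)
  clockedSearch≡2+ (suc c) n eq | suc r | _ = clockedSearch≡2+ c n (trans eq₁ eq)

  clockedSearch-positive : ∀ c → (∀ i → i < c → ClockedPositive i) → clockedSearch f t xs c ≡ 0
  clockedSearch-positive zero _ = refl
  clockedSearch-positive (suc c) pos with pos c ≤-refl
  ... | v , eq rewrite clockedSearch-positive c (λ i i<c → pos i (m<n⇒m<1+n i<c)) | eq = refl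

  clockedSearch-found : ∀ n → clocked f t (n ∷ xs) ≡ 1 → (∀ i → i < n → ClockedPositive i) →
                        ∀ c → n < c → clockedSearch f t xs c ≡ suc (suc n)
  clockedSearch-found n found pos (suc c) (s≤s n≤c) with m≤n⇒m<n∨m≡n n≤c
  ... | inj₁ n<c rewrite clockedSearch-found n found pos c n<c = refl
  ... | inj₂ refl rewrite clockedSearch-positive n pos | found = refl

mutual
  clocked-sound : ∀ {k} (e : Code k) t xs {y} → clocked e t xs ≡ suc y → Eval e xs y
  clocked-sound cz t xs refl = ev-cz
  clocked-sound succ t (x ∷ []) refl = ev-succ
  clocked-sound (proj i) t xs refl = ev-proj
  clocked-sound (comp f gs) t xs eq with ifPos-positive (allPositive (clocked* gs t xs)) _ eq
  ... | (_ , all) , eqf = ev-comp (clocked*-sound gs t xs all) (clocked-sound f t _ eqf)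
  clocked-sound (prec f g) t (n ∷ xs) eq = clockedRec-sound f g t n xs eq
  clocked-sound (mu f) t xs eq with clockedSearch≡2+ f t xs t _ (pred≡suc eq)
  ... | found , pos = ev-mu (clocked-sound f t _ found)
                            (λ i i<n → proj₁ (pos i i<n) , clocked-sound f t _ (proj₂ (pos i i<n)))

  clocked*-sound : ∀ {k m} (gs : Vec (Code k) m) t xs {a} → allPositive (clocked* gs t xs) ≡ suc a →
                   EvalAll gs xs (map pred (clocked* gs t xs))
  clocked*-sound [] t xs eq = []
  clocked*-sound (g ∷ gs) t xs eq with ifPos-positive (clocked g t xs) _ eq
  ... | (w , eqg) , all = subst (Eval g xs) (sym (cong pred eqg)) (clocked-sound g t xs eqg)
                          ∷ clocked*-sound gs t xs all

  clockedRec-sound : ∀ {k} (f : Code k) (g : Code (suc (suc k))) t n xs {y} →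
                     clockedRec f g t n xs ≡ suc y → Eval (prec f g) (n ∷ xs) y
  clockedRec-sound f g t zero xs eq = ev-prec0 (clocked-sound f t xs eq)
  clockedRec-sound f g t (suc n) xs eq with ifPos-positive (clockedRec f g t n xs) _ eq
  ... | (r , eqr) , eqg =
    ev-precS (clockedRec-sound f g t n xs eqr)
             (clocked-sound g t _ (subst (λ z → clocked g t (n ∷ pred z ∷ xs) ≡ suc _) eqr eqg))

Eventually : (ℕ → Set) → Set
Eventually P = Σ ℕ λ t₀ → ∀ t → t₀ ≤ t → P t

eventually-map : ∀ {P Q : ℕ → Set} → (∀ {t} → P t → Q t) → Eventually P → Eventually Q
eventually-map P⇒Q (t₀ , p) = t₀ , λ t t₀≤t → P⇒Q (p t t₀≤t)

eventually-× : ∀ {P Q : ℕ → Set} → Eventually P → Eventually Q → Eventually (λ t → P t × Q t)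
eventually-× (t₀ , p) (t₁ , q) =
  t₀ ⊔ t₁ , λ t le → p t (≤-trans (m≤m⊔n t₀ t₁) le) , q t (≤-trans (m≤n⊔m t₀ t₁) le)

eventually-∀< : ∀ {P : ℕ → ℕ → Set} n → (∀ i → i < n → Eventually (P i)) →
                Eventually (λ t → ∀ i → i < n → P i t)
eventually-∀< zero _ = 0 , λ _ _ _ ()
eventually-∀< {P} (suc n) ev =
  eventually-map combine (eventually-× (eventually-∀< n (λ i i<n → ev i (m<n⇒m<1+n i<n))) (ev n ≤-refl))
  where
  combine : ∀ {t} → (∀ i → i < n → P i t) × P n t → ∀ i → i < suc n → P i t
  combine (below , at) i i<1+n with m<1+n⇒m<n∨m≡n i<1+n
  ... | inj₁ i<n = below i i<n
  ... | inj₂ refl = at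

mutual
  clocked-complete : ∀ {k} {e : Code k} {xs y} → Eval e xs y → Eventually (λ t → clocked e t xs ≡ suc y)
  clocked-complete ev-cz = 0 , λ _ _ → refl
  clocked-complete ev-succ = 0 , λ _ _ → refl
  clocked-complete ev-proj = 0 , λ _ _ → refl
  clocked-complete {e = comp f gs} {xs} (ev-comp {ys = ys} ds d) =
    eventually-map value (eventually-× (clocked*-complete ds) (clocked-complete d))
    where
    value : ∀ {t} → clocked* gs t xs ≡ map suc ys × clocked f t ys ≡ suc _ → clocked (comp f gs) t xs ≡ suc _
    value {t} (eqs , eq) rewrite eqs | allPositive-map-suc ys | map-pred-suc ys = eq
  clocked-complete (ev-prec0 d) = clocked-complete d
  clocked-complete {e = prec f g} (ev-precS {n = n} {xs} r d) =
    eventually-map value (eventually-× (clocked-complete r) (clocked-complete d))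
    where
    value : ∀ {t} → clockedRec f g t n xs ≡ suc _ × clocked g t (n ∷ _ ∷ xs) ≡ suc _ →
            clocked (prec f g) t (suc n ∷ xs) ≡ suc _
    value (eqr , eqg) rewrite eqr = eqg
  clocked-complete {e = mu f} {xs} (ev-mu {n = n} d below) =
    eventually-map value
      (eventually-× (suc n , λ _ le → le)
        (eventually-× (clocked-complete d)
          (eventually-∀< n λ i i<n →
            eventually-map (proj₁ (below i i<n) ,_) (clocked-complete (proj₂ (below i i<n))))))
    where
    value : ∀ {t} → n < t × clocked f t (n ∷ xs) ≡ 1 × (∀ i → i < n → ClockedPositive f t xs i) →
            clocked (mu f) t xs ≡ suc n
    value {t} (n<t , found , pos) = cong pred (clockedSearch-found f t xs n found pos t n<t)

  clocked*-complete : ∀ {k m} {gs : Vec (Code k) m} {xs ys} → EvalAll gs xs ys →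
                      Eventually (λ t → clocked* gs t xs ≡ map suc ys)
  clocked*-complete [] = 0 , λ _ _ → refl
  clocked*-complete (d ∷ ds) =
    eventually-map (λ (eq , eqs) → cong₂ _∷_ eq eqs) (eventually-× (clocked-complete d) (clocked*-complete ds))

-- Search and listable relations

LeastZero : (ℕ → ℕ) → ℕ → Set
LeastZero g m = g m ≡ 0 × (∀ i → i < m → Σ ℕ λ v → g i ≡ suc v)

leastZero-below : (g : ℕ → ℕ) → ∀ n →
                  Σ ℕ (LeastZero g) ⊎ (∀ i → i < n → Σ ℕ λ v → g i ≡ suc v)
leastZero-below g zero = inj₂ (λ _ ())
leastZero-below g (suc n) with leastZero-below g n
... | inj₁ least = inj₁ least
... | inj₂ pos with g n in eq
... | zero = inj₁ (n , eq , pos)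
... | suc v = inj₂ extend
  where
  extend : ∀ i → i < suc n → Σ ℕ λ v → g i ≡ suc v
  extend i i<1+n with m<1+n⇒m<n∨m≡n i<1+n
  ... | inj₁ i<n = pos i i<n
  ... | inj₂ refl = v , eq

leastZero : (g : ℕ → ℕ) → ∀ n → g n ≡ 0 → Σ ℕ (LeastZero g)
leastZero g n gn≡0 with leastZero-below g (suc n)
... | inj₁ least = least
... | inj₂ pos = ⊥-elim (0≢1+n (trans (sym gn≡0) (proj₂ (pos n ≤-refl))))

leastZero-unique : ∀ {g g′ m m′} → LeastZero g m → LeastZero g′ m′ →
                   (∀ x → g x ≡ 0 → g′ x ≡ 0) → (∀ x → g′ x ≡ 0 → g x ≡ 0) → m ≡ m′
leastZero-unique {m = m} {m′} (zero-m , pos) (zero-m′ , pos′) g⇒g′ g′⇒g with <-cmp m m′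
... | tri< m<m′ _ _ = ⊥-elim (0≢1+n (trans (sym (g⇒g′ m zero-m)) (proj₂ (pos′ m m<m′))))
... | tri≈ _ m≡m′ _ = m≡m′
... | tri> _ _ m′<m = ⊥-elim (0≢1+n (trans (sym (g′⇒g m′ zero-m′)) (proj₂ (pos m′ m′<m))))

μ-eval : ∀ {k f} (c : Computable (suc k) f) {xs n} → LeastZero (λ i → f (i ∷ xs)) n →
         Eval (mu (proj₁ c)) xs n
μ-eval (c , ev) (zero-n , pos) =
  ev-mu (subst (Eval c _) zero-n (ev _))
        (λ i i<n → proj₁ (pos i i<n) , subst (Eval c _) (proj₂ (pos i i<n)) (ev _))

μ-zero : ∀ {k f} (c : Computable (suc k) f) {xs n} → Eval (mu (proj₁ c)) xs n → f (n ∷ xs) ≡ 0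
μ-zero (c , ev) (ev-mu d _) = Eval-deterministic (ev _) d

isZero≡0 : ∀ {a} → isZero a ≡ 0 → Σ ℕ λ w → a ≡ suc w
isZero≡0 {suc a} _ = a , refl

firstNonzero : (ℕ → ℕ) → ℕ → ℕ
firstNonzero g zero = 0
firstNonzero g (suc b) = firstNonzero g b orElse g b

orElse-positive : ∀ r a {v} → a ≡ suc v → Σ ℕ λ w → r orElse a ≡ suc w
orElse-positive zero a {v} eq = v , eq
orElse-positive (suc r) a eq = r , refl

firstNonzero-positive : ∀ g b j {v} → j < b → g j ≡ suc v → Σ ℕ λ w → firstNonzero g b ≡ suc w
firstNonzero-positive g (suc b) j j<1+b eq with m<1+n⇒m<n∨m≡n j<1+b
... | inj₂ refl = orElse-positive (firstNonzero g b) (g j) eq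
... | inj₁ j<b with firstNonzero-positive g b j j<b eq
...   | w , eq′ rewrite eq′ = w , refl

firstNonzero-witness : ∀ g b {w} → firstNonzero g b ≡ suc w → Σ ℕ λ j → j < b × Σ ℕ λ v → g j ≡ suc v
firstNonzero-witness g (suc b) eq with firstNonzero g b in eq′
... | zero = b , ≤-refl , _ , eq
... | suc _ with firstNonzero-witness g b eq′
...   | j , j<b , pos = j , m<n⇒m<1+n j<b , pos

-- Dovetailing: search for the least clock z at which some j ≤ z is seen to make
-- e halt on j ∷ xs, then for the least j seen at clock z.
module Dovetail {k} (e : Code (suc k)) where

  seenᵛ : Vec ℕ (suc (suc k)) → ℕ
  seenᵛ (b ∷ z ∷ xs) = firstNonzero (λ j → clocked e z (j ∷ xs)) b

  seenStep : Vec ℕ (suc (suc (suc k))) → ℕ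
  seenStep (b ∷ acc ∷ z ∷ xs) = acc orElse clocked e z (b ∷ xs)

  seenStep-computable : Computable (suc (suc (suc k))) seenStep
  seenStep-computable = computable-term
    (app₂ orElse-computable (var (fsuc fzero))
      (app (clocked-computable e) (var (fsuc (fsuc fzero)) ∷ var fzero ∷ varsAfter 3)))
    λ { (b ∷ acc ∷ z ∷ xs) → cong (λ ys → acc orElse clocked e z (b ∷ ys))
                                  (⟦varsAfter⟧ 3 (b ∷ acc ∷ z ∷ []) xs) }

  seen-primRec : ∀ b z xs → primRec (λ _ → 0) seenStep (b ∷ z ∷ xs) ≡ seenᵛ (b ∷ z ∷ xs)
  seen-primRec zero z xs = refl
  seen-primRec (suc b) z xs = cong (_orElse clocked e z (b ∷ xs)) (seen-primRec b z xs)

  seen-computable : Computable (suc (suc k)) seenᵛ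
  seen-computable = Computable-cong (λ { (b ∷ z ∷ xs) → seen-primRec b z xs })
    (primRec-computable (const-computable 0) seenStep-computable)

  stageTest : Vec ℕ (suc k) → ℕ
  stageTest (z ∷ xs) = isZero (seenᵛ (suc z ∷ z ∷ xs))

  stageTest-computable : Computable (suc k) stageTest
  stageTest-computable = computable-term
    (app₁ isZero-computable (app seen-computable (app₁ suc-computable (var fzero) ∷ var fzero ∷ varsAfter 1)))
    λ { (z ∷ xs) → cong (λ ys → isZero (seenᵛ (suc z ∷ z ∷ ys))) (⟦varsAfter⟧ 1 (z ∷ []) xs) }

  indexTest : Vec ℕ (suc (suc k)) → ℕ
  indexTest (j ∷ z ∷ xs) = isZero (clocked e z (j ∷ xs))

  indexTest-computable : Computable (suc (suc k)) indexTest
  indexTest-computable = computable-term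
    (app₁ isZero-computable (app (clocked-computable e) (var (fsuc fzero) ∷ var fzero ∷ varsAfter 2)))
    λ { (j ∷ z ∷ xs) → cong (λ ys → isZero (clocked e z (j ∷ ys))) (⟦varsAfter⟧ 2 (j ∷ z ∷ []) xs) }

  search : Code k
  search = comp (mu (proj₁ indexTest-computable)) (mu (proj₁ stageTest-computable) ∷ identityCodes k)

  search-sound : ∀ {xs j} → Eval search xs j → Σ ℕ λ y → Eval e (j ∷ xs) y
  search-sound {xs} {j} (ev-comp (_∷_ {y = z} _ ids) ev) with EvalAll-deterministic ids (identityCodes-eval xs)
  ... | refl with isZero≡0 (μ-zero indexTest-computable ev)
  ...   | y , halts = y , clocked-sound e z (j ∷ xs) halts

  search-complete : ∀ {xs j y} → Eval e (j ∷ xs) y → Σ ℕ λ j′ → Eval search xs j′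
  search-complete {xs} {j} ev =
    let (t₀ , halts) = clocked-complete ev
        z = t₀ ⊔ j
        (_ , seen) = firstNonzero-positive (λ j → clocked e z (j ∷ xs)) (suc z) j
                       (s≤s (m≤n⊔m t₀ j)) (halts z (m≤m⊔n t₀ j))
        (z* , stage) = leastZero (λ z → stageTest (z ∷ xs)) z (cong isZero seen)
        (_ , seen*) = isZero≡0 (proj₁ stage)
        (j′ , _ , _ , halts′) = firstNonzero-witness (λ j → clocked e z* (j ∷ xs)) (suc z*) seen*
        (j* , index) = leastZero (λ j → indexTest (j ∷ z* ∷ xs)) j′ (cong isZero halts′)
    in j* , ev-comp (μ-eval stageTest-computable stage ∷ identityCodes-eval xs) (μ-eval indexTest-computable index)

record Selector {k} (P : Vec ℕ (suc k) → Set) : Set where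
  field
    code     : Code k
    sound    : ∀ {xs j} → Eval code xs j → P (j ∷ xs)
    complete : ∀ {xs} j → P (j ∷ xs) → Σ ℕ λ j′ → Eval code xs j′

selector : ∀ {k} {P : Vec ℕ (suc k) → Set} → Listable P → Selector P
selector {P = P} (e , P⇔halts) = record
  { code = search
  ; sound = λ {xs} {j} ev → Equivalence.from (P⇔halts (j ∷ xs)) (search-sound ev)
  ; complete = λ {xs} j p → search-complete (proj₂ (Equivalence.to (P⇔halts (j ∷ xs)) p))
  }
  where open Dovetail e

Listable-∃ : ∀ {k} {P : Vec ℕ (suc k) → Set} → Listable P → Listable (λ xs → Σ ℕ λ j → P (j ∷ xs))
Listable-∃ L = code , λ xs → mk⇔ (λ (j , p) → complete j p) (λ (j , ev) → j , sound ev)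
  where open Selector (selector L)

Listable-⇔ : ∀ {k} {P Q : Vec ℕ k → Set} → (∀ xs → P xs ⇔ Q xs) → Listable Q → Listable P
Listable-⇔ P⇔Q (e , Q⇔halts) = e , λ xs → Q⇔halts xs ⇔-∘ P⇔Q xs

Listable-comp : ∀ {k m} {Q : Vec ℕ m → Set} (gs : Vec (Code k) m) → Listable Q →
                Listable (λ xs → Σ (Vec ℕ m) λ ys → EvalAll gs xs ys × Q ys)
Listable-comp gs (e , Q⇔halts) = comp e gs , λ xs → mk⇔
  (λ (ys , evs , q) → let (y , ev) = Equivalence.to (Q⇔halts ys) q in y , ev-comp evs ev)
  (λ { (y , ev-comp evs ev) → _ , evs , Equivalence.from (Q⇔halts _) (y , ev) })

Listable-× : ∀ {k} {P Q : Vec ℕ k → Set} → Listable P → Listable Q → Listable (λ xs → P xs × Q xs)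
Listable-× (eP , P⇔halts) (eQ , Q⇔halts) = comp cz (eP ∷ eQ ∷ []) , λ xs → mk⇔
  (λ (p , q) → let (_ , evP) = Equivalence.to (P⇔halts xs) p
                   (_ , evQ) = Equivalence.to (Q⇔halts xs) q
               in 0 , ev-comp (evP ∷ evQ ∷ []) ev-cz)
  (λ { (_ , ev-comp (evP ∷ evQ ∷ []) ev-cz) →
         Equivalence.from (P⇔halts xs) (_ , evP) , Equivalence.from (Q⇔halts xs) (_ , evQ) })

-- Index translations

Coincide : ∀ {M : Set} → (ℕ → M) → (ℕ → M) → Vec ℕ 2 → Set
Coincide α β (i ∷ j ∷ []) = α i ≡ β j

record Translation {M : Set} (ρ γ : ℕ → M) : Set where
  field
    code    : Code 1
    total   : ∀ x → Σ ℕ λ j → Eval code (x ∷ []) j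
    correct : ∀ {x j} → Eval code (x ∷ []) j → γ j ≡ ρ x

module _ {M : Set} {ρ γ : ℕ → M} (T : Translation ρ γ) where
  open Translation T

  translateAll : ∀ {r m} → Vec (Fin r) m → Vec (Code r) m
  translateAll = map (λ i → comp code (proj i ∷ []))

  translateAll-total : ∀ {r m} (is : Vec (Fin r) m) xs → Σ (Vec ℕ m) (EvalAll (translateAll is) xs)
  translateAll-total [] xs = [] , []
  translateAll-total (i ∷ is) xs =
    let (j , ev) = total (lookup xs i)
        (js , evs) = translateAll-total is xs
    in j ∷ js , ev-comp (ev-proj ∷ []) ev ∷ evs

  translateAll-correct : ∀ {r m} (is : Vec (Fin r) m) {xs js} → EvalAll (translateAll is) xs js →
                         map γ js ≡ map ρ (map (lookup xs) is)
  translateAll-correct [] [] = refl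
  translateAll-correct (i ∷ is) (ev-comp (ev-proj ∷ []) ev ∷ evs) =
    cong₂ _∷_ (correct ev) (translateAll-correct is evs)

  Translation⇒ClassIncluded : ClassIncluded γ ρ
  Translation⇒ClassIncluded r X γ-listable =
    Listable-⇔ (λ xs → mk⇔ (to xs) from) (Listable-comp (translateAll (allFin r)) γ-listable)
    where
    same : ∀ {xs js} → EvalAll (translateAll (allFin r)) xs js → map γ js ≡ map ρ xs
    same {xs} evs = trans (translateAll-correct (allFin r) evs) (cong (map ρ) (map-lookup-allFin xs))

    to : ∀ xs → X (map ρ xs) → Σ (Vec ℕ r) λ js → EvalAll (translateAll (allFin r)) xs js × X (map γ js)
    to xs x = let (js , evs) = translateAll-total (allFin r) xs in js , evs , subst X (sym (same evs)) x

    from : ∀ {xs} → (Σ (Vec ℕ r) λ js → EvalAll (translateAll (allFin r)) xs js × X (map γ js)) → X (map ρ xs)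
    from (js , evs , x) = subst X (same evs) x

Coincide-listable⇒Translation : ∀ {M : Set} {ρ γ : ℕ → M} → Surjective γ → Listable (Coincide γ ρ) →
                       Translation ρ γ
Coincide-listable⇒Translation {ρ = ρ} γ-onto L = record
  { code = code
  ; total = λ x → let (j , γj≡ρx) = γ-onto (ρ x) in complete j γj≡ρx
  ; correct = sound
  }
  where open Selector (selector L)

EquivalentPres⇒Translation : ∀ {M : Set} {ρ γ : ℕ → M} → EquivalentPres ρ γ → Translation γ ρ
EquivalentPres⇒Translation {ρ = ρ} (φ , (c , ev) , γ≡ρ∘φ) = record
  { code = c
  ; total = λ x → φ x , ev x
  ; correct = λ {x} d → trans (cong ρ (Eval-deterministic d (ev x))) (sym (γ≡ρ∘φ x))
  }

Translation⇒EquivalentPres : ∀ {M : Set} {ρ γ : ℕ → M} → Translation γ ρ → EquivalentPres ρ γ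
Translation⇒EquivalentPres T =
  (λ n → proj₁ (total n)) , (code , λ n → proj₂ (total n)) , λ n → sym (correct (proj₂ (total n)))
  where open Translation T

EquivalentPres⇒Coincide-listable : ∀ {M : Set} {ρ γ : ℕ → M} → EquivalentPres ρ γ →
                                Listable (pullback ρ EqRel) → Listable (Coincide γ ρ)
EquivalentPres⇒Coincide-listable {ρ = ρ} {γ} (φ , (c , ev) , γ≡ρ∘φ) ρ-eq =
  Listable-⇔ (λ { (j ∷ x ∷ []) → mk⇔ (to j x) from }) (Listable-comp args ρ-eq)
  where
  args : Vec (Code 2) 2
  args = comp c (proj fzero ∷ []) ∷ proj (fsuc fzero) ∷ []

  to : ∀ j x → γ j ≡ ρ x → Σ (Vec ℕ 2) λ ys → EvalAll args (j ∷ x ∷ []) ys × pullback ρ EqRel ys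
  to j x γj≡ρx = _ , ev-comp (ev-proj ∷ []) (ev j) ∷ ev-proj ∷ [] , trans (sym (γ≡ρ∘φ j)) γj≡ρx

  from : ∀ {j x} → (Σ (Vec ℕ 2) λ ys → EvalAll args (j ∷ x ∷ []) ys × pullback ρ EqRel ys) → γ j ≡ ρ x
  from {j} (_ , ev-comp (ev-proj ∷ []) d ∷ ev-proj ∷ [] , ρφj≡ρx) =
    trans (γ≡ρ∘φ j) (trans (cong ρ (Eval-deterministic (ev j) d)) ρφj≡ρx)

EquivalentPres⇒ClassEqual : ∀ {M : Set} {ρ γ : ℕ → M} → Surjective γ → Listable (pullback ρ EqRel) →
                        EquivalentPres ρ γ → ClassEqual ρ γ
EquivalentPres⇒ClassEqual γ-onto ρ-eq equiv =
    Translation⇒ClassIncluded (EquivalentPres⇒Translation equiv)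
  , Translation⇒ClassIncluded (Coincide-listable⇒Translation γ-onto (EquivalentPres⇒Coincide-listable equiv ρ-eq))

-- Presentations with decidable equality

module Canonical {M : Set} (ρ : ℕ → M) (ρ-dec : DecidableSet (Eq-of ρ)) where

  eqTest : ℕ → ℕ → ℕ
  eqTest m n with proj₂ ρ-dec (m ∷ n ∷ [])
  ... | inj₁ _ = 0
  ... | inj₂ _ = 1

  eqTest-computable : Computable₂ eqTest
  eqTest-computable = proj₁ ρ-dec , λ { (m ∷ n ∷ []) → eval m n }
    where
    eval : ∀ m n → Eval (proj₁ ρ-dec) (m ∷ n ∷ []) (eqTest m n)
    eval m n with proj₂ ρ-dec (m ∷ n ∷ [])
    ... | inj₁ (_ , ev) = ev
    ... | inj₂ (_ , ev) = ev

  eqTest≡0⇒ : ∀ {m n} → eqTest m n ≡ 0 → ρ m ≡ ρ n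
  eqTest≡0⇒ {m} {n} _ with proj₂ ρ-dec (m ∷ n ∷ [])
  ... | inj₁ (ρm≡ρn , _) = ρm≡ρn

  ⇒eqTest≡0 : ∀ {m n} → ρ m ≡ ρ n → eqTest m n ≡ 0
  ⇒eqTest≡0 {m} {n} ρm≡ρn with proj₂ ρ-dec (m ∷ n ∷ [])
  ... | inj₁ _ = refl
  ... | inj₂ (ρm≢ρn , _) = ⊥-elim (ρm≢ρn ρm≡ρn)

  canon-spec : ∀ i → Σ ℕ (LeastZero (λ i′ → eqTest i′ i))
  canon-spec i = leastZero _ i (⇒eqTest≡0 refl)

  canon : ℕ → ℕ
  canon i = proj₁ (canon-spec i)

  canon-computable : Computable₁ canon
  canon-computable =
    mu (proj₁ eqTest-computable) , λ { (i ∷ []) → μ-eval eqTest-computable (proj₂ (canon-spec i)) }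

  ρ-canon : ∀ i → ρ (canon i) ≡ ρ i
  ρ-canon i = eqTest≡0⇒ (proj₁ (proj₂ (canon-spec i)))

  canon-≤ : ∀ i → canon i ≤ i
  canon-≤ i = ≮⇒≥ λ i<canon →
    0≢1+n (trans (sym (⇒eqTest≡0 refl)) (proj₂ (proj₂ (proj₂ (canon-spec i)) i i<canon)))

  canon-cong : ∀ {i i′} → ρ i ≡ ρ i′ → canon i ≡ canon i′
  canon-cong ρi≡ρi′ = leastZero-unique (proj₂ (canon-spec _)) (proj₂ (canon-spec _))
    (λ x eq → ⇒eqTest≡0 (trans (eqTest≡0⇒ eq) ρi≡ρi′))
    (λ x eq → ⇒eqTest≡0 (trans (eqTest≡0⇒ eq) (sym ρi≡ρi′)))

  Canonical : ℕ → Set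
  Canonical i = canon i ≡ i

  canon-canonical : ∀ i → Canonical (canon i)
  canon-canonical i = canon-cong (ρ-canon i)

  canonical-0 : Canonical 0
  canonical-0 = n≤0⇒n≡0 (canon-≤ 0)

  -- Zero exactly when m is a canonical index above i.
  nextTest : Vec ℕ 2 → ℕ
  nextTest (m ∷ i ∷ []) = (suc i ∸ m) orElse (m ∸ canon m)

  nextTest-computable : Computable 2 nextTest
  nextTest-computable = computable-term
    (app₂ orElse-computable
      (app₂ ∸-computable (app₁ suc-computable (var (fsuc fzero))) (var fzero))
      (app₂ ∸-computable (var fzero) (app₁ canon-computable (var fzero))))
    λ { (m ∷ i ∷ []) → refl }

  next : Code 1
  next = mu (proj₁ nextTest-computable)

  next-canonical : ∀ {i w} → Eval next (i ∷ []) w → Canonical w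
  next-canonical {i} {w} ev with μ-zero nextTest-computable ev
  ... | eq with suc i ∸ w
  ...   | zero = ≤-antisym (canon-≤ w) (m∸n≡0⇒m≤n eq)

  NoCanonicalIn : ℕ → ℕ → Set
  NoCanonicalIn i n = ∀ x → i < x → x ≤ n → ¬ Canonical x

  lastCanonical : ∀ n → Σ ℕ λ i → i ≤ n × Canonical i × NoCanonicalIn i n
  lastCanonical zero = 0 , z≤n , canonical-0 , λ x 0<x x≤0 _ → <-irrefl refl (<-≤-trans 0<x x≤0)
  lastCanonical (suc n) with canon (suc n) ≟ suc n
  ... | yes can = suc n , ≤-refl , can , λ x n<x x≤n _ → <-irrefl refl (<-≤-trans n<x x≤n)
  ... | no ¬can =
    let (i , i≤n , can , none) = lastCanonical n
    in i , m≤n⇒m≤1+n i≤n , can , λ x i<x x≤1+n → extend x i<x (m≤n⇒m<n∨m≡n x≤1+n) none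
    where
    extend : ∀ {i} x → i < x → x < suc n ⊎ x ≡ suc n → NoCanonicalIn i n → ¬ Canonical x
    extend x i<x (inj₁ x<1+n) none = none x i<x (≤-pred x<1+n)
    extend x i<x (inj₂ refl) none = ¬can

  next-eval : ∀ {i n} → i ≤ n → NoCanonicalIn i n → Canonical (suc n) → Eval next (i ∷ []) (suc n)
  next-eval {i} {n} i≤n none can = μ-eval nextTest-computable (found , below)
    where
    found : nextTest (suc n ∷ i ∷ []) ≡ 0
    found rewrite m≤n⇒m∸n≡0 i≤n | can | n∸n≡0 n = refl

    positive : ∀ {a b} → a < b → Σ ℕ λ v → b ∸ a ≡ suc v
    positive {zero} {suc b} _ = b , refl
    positive {suc a} {suc b} (s≤s a<b) = positive a<b

    below : ∀ x → x < suc n → Σ ℕ λ v → nextTest (x ∷ i ∷ []) ≡ suc v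
    below x x<1+n with x ≤? i
    ... | yes x≤i = let (v , eq) = positive (s≤s x≤i) in v , cong (_orElse (x ∸ canon x)) eq
    ... | no x≰i =
      let i<x = ≰⇒> x≰i
          (v , eq) = positive (≤∧≢⇒< (canon-≤ x) (none x i<x (≤-pred x<1+n)))
      in v , trans (cong (_orElse (x ∸ canon x)) (m≤n⇒m∸n≡0 i<x)) eq

  enum : Code 1
  enum = prec cz (comp next (proj (fsuc fzero) ∷ []))

  enum-canonical : ∀ {k i} → Eval enum (k ∷ []) i → Canonical i
  enum-canonical (ev-prec0 ev-cz) = canonical-0
  enum-canonical (ev-precS _ (ev-comp (ev-proj ∷ []) ev)) = next-canonical ev

  enum-onto : ∀ {i} → Canonical i → Σ ℕ λ k → Eval enum (k ∷ []) i
  enum-onto {i} = bounded i i ≤-refl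
    where
    bounded : ∀ b i → i ≤ b → Canonical i → Σ ℕ λ k → Eval enum (k ∷ []) i
    bounded b zero _ _ = 0 , ev-prec0 ev-cz
    bounded (suc b) (suc n) (s≤s n≤b) can =
      let (i , i≤n , can-i , none) = lastCanonical n
          (k , ev) = bounded b i (≤-trans i≤n n≤b) can-i
      in suc k , ev-precS ev (ev-comp (ev-proj ∷ []) (next-eval i≤n none can))

  Successor : Vec M 2 → Set
  Successor (x ∷ y ∷ []) = Σ ℕ λ i → Σ ℕ λ w → ρ i ≡ x × Eval next (canon i ∷ []) w × ρ w ≡ y

  Successor-listable : Listable (pullback ρ EqRel) → ρListable ρ Successor
  Successor-listable ρ-eq =
    Listable-⇔ (λ { (m ∷ n ∷ []) → mk⇔ (to m n) (from m n) }) (Listable-comp args ρ-eq)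
    where
    args : Vec (Code 2) 2
    args = proj (fsuc fzero) ∷ comp next (comp (proj₁ canon-computable) (proj fzero ∷ []) ∷ []) ∷ []

    to : ∀ m n → Successor (ρ m ∷ ρ n ∷ []) →
         Σ (Vec ℕ 2) λ ys → EvalAll args (m ∷ n ∷ []) ys × pullback ρ EqRel ys
    to m n (i , w , ρi≡ρm , ev , ρw≡ρn) =
      _ , ev-proj ∷ ev-comp (ev-comp (ev-proj ∷ []) (proj₂ canon-computable (m ∷ [])) ∷ [])
                            (subst (λ c → Eval next (c ∷ []) w) (canon-cong ρi≡ρm) ev) ∷ []
        , sym ρw≡ρn

    from : ∀ m n → (Σ (Vec ℕ 2) λ ys → EvalAll args (m ∷ n ∷ []) ys × pullback ρ EqRel ys) →
           Successor (ρ m ∷ ρ n ∷ [])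
    from m n (_ , ev-proj ∷ ev-comp (ev-comp (ev-proj ∷ []) ev-canon ∷ []) ev ∷ [] , ρn≡ρw) =
      m , _ , refl
        , subst (λ c → Eval next (c ∷ []) _) (Eval-deterministic ev-canon (proj₂ canon-computable (m ∷ []))) ev
        , sym ρn≡ρw

module _ {M : Set} {ρ γ : ℕ → M} (ρ-dec : DecidableSet (Eq-of ρ))
         (ρ-eq : Listable (pullback ρ EqRel)) (γ-eq : Listable (pullback γ EqRel))
         (ρ-onto : Surjective ρ) (γ-onto : Surjective γ) (included : ClassIncluded ρ γ) where
  open Canonical ρ ρ-dec

  SuccessorIndexᵞ : Vec ℕ 2 → Set
  SuccessorIndexᵞ (j ∷ p ∷ []) = Successor (γ p ∷ γ j ∷ [])

  successorᵞ : Selector SuccessorIndexᵞ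
  successorᵞ =
    selector (Listable-⇔ (λ { (j ∷ p ∷ []) → mk⇔ to from }) (Listable-comp swap Successorᵞ-listable))
    where
    Successorᵞ-listable : ρListable γ Successor
    Successorᵞ-listable = included 2 Successor (Successor-listable ρ-eq)

    swap : Vec (Code 2) 2
    swap = proj (fsuc fzero) ∷ proj fzero ∷ []

    to : ∀ {j p} → SuccessorIndexᵞ (j ∷ p ∷ []) →
         Σ (Vec ℕ 2) λ ys → EvalAll swap (j ∷ p ∷ []) ys × pullback γ Successor ys
    to s = _ , ev-proj ∷ ev-proj ∷ [] , s

    from : ∀ {j p} → (Σ (Vec ℕ 2) λ ys → EvalAll swap (j ∷ p ∷ []) ys × pullback γ Successor ys) →
           SuccessorIndexᵞ (j ∷ p ∷ [])
    from (_ , ev-proj ∷ ev-proj ∷ [] , s) = s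

  module successorᵞ = Selector successorᵞ

  γ-index-of-0 : Σ ℕ λ j → γ j ≡ ρ 0
  γ-index-of-0 = γ-onto (ρ 0)

  enumᵞ : Code 1
  enumᵞ = prec (proj₁ (const-computable (proj₁ γ-index-of-0)))
               (comp successorᵞ.code (proj (fsuc fzero) ∷ []))

  enumᵞ-correct : ∀ k {i j} → Eval enum (k ∷ []) i → Eval enumᵞ (k ∷ []) j → γ j ≡ ρ i
  enumᵞ-correct zero (ev-prec0 ev-cz) (ev-prec0 ev) =
    trans (cong γ (Eval-deterministic ev (proj₂ (const-computable (proj₁ γ-index-of-0)) [])))
          (proj₂ γ-index-of-0)
  enumᵞ-correct (suc k) (ev-precS ev-i (ev-comp (ev-proj ∷ []) ev-next))
                        (ev-precS ev-j (ev-comp (ev-proj ∷ []) ev-step)) =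
    let (i′ , w′ , ρi′≡γj , ev-next′ , ρw′≡γj′) = successorᵞ.sound ev-step
        canon-i′ = trans (canon-cong (trans ρi′≡γj (enumᵞ-correct k ev-i ev-j))) (enum-canonical ev-i)
        w′≡i = Eval-deterministic (subst (λ c → Eval next (c ∷ []) w′) canon-i′ ev-next′) ev-next
    in trans (sym ρw′≡γj′) (cong ρ w′≡i)

  enumᵞ-total : ∀ k {i} → Eval enum (k ∷ []) i → Σ ℕ λ j → Eval enumᵞ (k ∷ []) j
  enumᵞ-total zero _ = proj₁ γ-index-of-0 , ev-prec0 (proj₂ (const-computable (proj₁ γ-index-of-0)) [])
  enumᵞ-total (suc k) {i} (ev-precS {y = i′} ev-i′ (ev-comp (ev-proj ∷ []) ev-next)) =
    let (j′ , ev-j′) = enumᵞ-total k ev-i′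
        (j , γj≡ρi) = γ-onto (ρ i)
        s : SuccessorIndexᵞ (j ∷ j′ ∷ [])
        s = i′ , i , sym (enumᵞ-correct k ev-i′ ev-j′)
              , subst (λ c → Eval next (c ∷ []) i) (sym (enum-canonical ev-i′)) ev-next , sym γj≡ρi
        (j″ , ev-step) = successorᵞ.complete j s
    in j″ , ev-precS ev-j′ (ev-comp (ev-proj ∷ []) ev-step)

  Coincide-listable : Listable (Coincide ρ γ)
  Coincide-listable =
    Listable-⇔ (λ { (m ∷ n ∷ []) → mk⇔ (to m n) (from m n) })
      (Listable-∃ (Listable-× (Listable-comp enumArgs ρ-eq) (Listable-comp enumᵞArgs γ-eq)))
    where
    enumArgs enumᵞArgs : Vec (Code 3) 2
    enumArgs = comp enum (proj fzero ∷ []) ∷ proj (fsuc fzero) ∷ []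
    enumᵞArgs = comp enumᵞ (proj fzero ∷ []) ∷ proj (fsuc (fsuc fzero)) ∷ []

    Matched : ℕ → ℕ → ℕ → Set
    Matched k m n = (Σ (Vec ℕ 2) λ ys → EvalAll enumArgs (k ∷ m ∷ n ∷ []) ys × pullback ρ EqRel ys)
                  × (Σ (Vec ℕ 2) λ ys → EvalAll enumᵞArgs (k ∷ m ∷ n ∷ []) ys × pullback γ EqRel ys)

    to : ∀ m n → ρ m ≡ γ n → Σ ℕ λ k → Matched k m n
    to m n ρm≡γn =
      let (k , ev-i) = enum-onto (canon-canonical m)
          (j , ev-j) = enumᵞ-total k ev-i
          γj≡γn = trans (enumᵞ-correct k ev-i ev-j) (trans (ρ-canon m) ρm≡γn)
      in k , (_ , ev-comp (ev-proj ∷ []) ev-i ∷ ev-proj ∷ [] , ρ-canon m)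
           , (_ , ev-comp (ev-proj ∷ []) ev-j ∷ ev-proj ∷ [] , γj≡γn)

    from : ∀ m n → (Σ ℕ λ k → Matched k m n) → ρ m ≡ γ n
    from m n (k , (_ , ev-comp (ev-proj ∷ []) ev-i ∷ ev-proj ∷ [] , ρi≡ρm)
                , (_ , ev-comp (ev-proj ∷ []) ev-j ∷ ev-proj ∷ [] , γj≡γn)) =
      trans (sym ρi≡ρm) (trans (sym (enumᵞ-correct k ev-i ev-j)) γj≡γn)

  ClassIncluded⇒EquivalentPres : EquivalentPres ρ γ
  ClassIncluded⇒EquivalentPres =
    Translation⇒EquivalentPres (Coincide-listable⇒Translation ρ-onto Coincide-listable)

theorem3p21 : (L : Language) (𝔐 : Structure L) → ListableStructure 𝔐 →
    (ρ γ : ℕ → Structure.Carrier 𝔐) →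
    ListablePresentation 𝔐 ρ → ListablePresentation 𝔐 γ →
    ((EquivalentPres ρ γ → ClassEqual ρ γ)
     × (ClassEqual ρ γ → ClassIncluded ρ γ)
     × (DecidableSet (Eq-of ρ) →
          (EquivalentPres ρ γ → ClassEqual ρ γ)
        × (ClassEqual ρ γ → ClassIncluded ρ γ)
        × (ClassIncluded ρ γ → EquivalentPres ρ γ)))
theorem3p21 L 𝔐 _ ρ γ Pρ Pγ = i⇒ii , proj₁ , λ ρ-dec → i⇒ii , proj₁ , iii⇒i ρ-dec
  where
  open ListablePresentation
  i⇒ii : EquivalentPres ρ γ → ClassEqual ρ γ
  i⇒ii = EquivalentPres⇒ClassEqual (surjective Pγ) (eqListable Pρ)
  iii⇒i : DecidableSet (Eq-of ρ) → ClassIncluded ρ γ → EquivalentPres ρ γ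
  iii⇒i ρ-dec =
    ClassIncluded⇒EquivalentPres ρ-dec (eqListable Pρ) (eqListable Pγ) (surjective Pρ) (surjective Pγ)
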